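{- Each of the following classes of algebras is equationally definable (i.e. is a variety): (a) the class of upper wBCK*-semilattices $(A,\vee,\to,1)$; (b) the class of lower wBCK*-semilattices $(A,\wedge,\to,1)$, as well as its subclass of weakly contractive ones and its subclass of sectionally j-pseudocomplemented ones; (c) the class of wBCK*-lattices $(A,\wedge,\vee,\to,1)$, as well as its subclass of weakly contractive ones and its subclass of sectionally j-pseudocomplemented ones; (d) the class of upper semilattice-ordered pocrigs $(A,\vee,\cdot,\to,1)$; (e) the class of lower semilattice-ordered pocrigs $(A,\wedge,\cdot,\to,1)$; (f) the class of lattice-ordered pocrigs $(A,\wedge,\vee,\cdot,\to,1)$.
   Context: A wBCK*-algebra is an algebra $(A,\to,1)$ where $A$ is a poset with order $\le$ and greatest element $1$, $x\le y$ iff $x\to y=1$, and for all $x,y,z$: if $x\le y\to z$ then $y\le x\to z$. It is weakly contractive if $x\le x\to y$ implies $x\le y$; it is sectionally j-pseudocomplemented if it is weakly contractive and moreover $x\le y\to(x\wedge y)$ whenever the meet $x\wedge y$ exists. An upper (lower) wBCK*-semilattice is an algebra $(A,\vee,\to,1)$ (resp. $(A,\wedge,\to,1)$) where $(A,\vee)$ is a join-semilattice (resp. $(A,\wedge)$ a meet-semilattice) and $(A,\to,1)$ is a wBCK*-algebra with respect to the semilattice order; a wBCK*-lattice is $(A,\wedge,\vee,\to,1)$ with $(A,\wedge,\vee)$ a lattice and $(A,\to,1)$ a wBCK*-algebra w.r.t. the lattice order. A pocrig is an algebra $(A,\cdot,\to,1)$ where $A$ is a poset, $\cdot$ is commutative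 and isotone, $1$ is a neutral element for $\cdot$ and the greatest element, and $x\le y\to z$ iff $xy\le z$. An upper (lower) semilattice-ordered, resp. lattice-ordered, pocrig is a pocrig whose order is that of a join-semilattice (meet-semilattice, lattice), with the semilattice (lattice) operations added to the signature. -}

module Defs where

open import Level using (0ℓ)
open import Data.Nat using (ℕ)
open import Data.Vec using (Vec; []; _∷_)
open import Data.Product using (Σ; _×_; _,_)
open import Relation.Binary.PropositionalEquality using (_≡_)
open import Relation.Binary.Structures using (IsPartialOrder)
open import Function.Bundles using (_⇔_)

record Signature : Set₁ where
  field
    Op    : Set
    arity : Op → ℕ
open Signature public

data Term (S : Signature) : Set where
  var : ℕ → Term S
  op  : (o : Op S) → Vec (Term S) (arity S o) → Term S

record Algebra (S : Signature) : Set₁ where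
  field
    Carrier : Set
    ⟦_⟧     : (o : Op S) → Vec Carrier (arity S o) → Carrier
open Algebra public

eval    : ∀ {S} (𝔸 : Algebra S) → (ℕ → Carrier 𝔸) → Term S → Carrier 𝔸
evalVec : ∀ {S} (𝔸 : Algebra S) → (ℕ → Carrier 𝔸) → ∀ {n} →
          Vec (Term S) n → Vec (Carrier 𝔸) n
eval 𝔸 ρ (var n)   = ρ n
eval 𝔸 ρ (op o ts) = ⟦ 𝔸 ⟧ o (evalVec 𝔸 ρ ts)
evalVec 𝔸 ρ []       = []
evalVec 𝔸 ρ (t ∷ ts) = eval 𝔸 ρ t ∷ evalVec 𝔸 ρ ts

Equation : Signature → Set
Equation S = Term S × Term S

_⊨_ : ∀ {S} → Algebra S → Equation S → Set
𝔸 ⊨ (s , t) = ∀ (ρ : ℕ → Carrier 𝔸) → eval 𝔸 ρ s ≡ eval 𝔸 ρ t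

EquationallyDefinable : ∀ {S} → (Algebra S → Set) → Set₁
EquationallyDefinable {S} K =
  Σ (Equation S → Set) λ E →
    ∀ (𝔸 : Algebra S) → K 𝔸 ⇔ (∀ e → E e → 𝔸 ⊨ e)

module _ {A : Set} where

  IsJoinSemilattice : (A → A → A) → Set
  IsJoinSemilattice _∨_ =
    (∀ x y z → (x ∨ y) ∨ z ≡ x ∨ (y ∨ z)) ×
    (∀ x y → x ∨ y ≡ y ∨ x) ×
    (∀ x → x ∨ x ≡ x)

  IsMeetSemilattice : (A → A → A) → Set
  IsMeetSemilattice _∧_ =
    (∀ x y z → (x ∧ y) ∧ z ≡ x ∧ (y ∧ z)) ×
    (∀ x y → x ∧ y ≡ y ∧ x) ×
    (∀ x → x ∧ x ≡ x)

  IsLattice : (A → A → A) → (A → A → A) → Set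
  IsLattice _∧_ _∨_ =
    IsMeetSemilattice _∧_ × IsJoinSemilattice _∨_ ×
    (∀ x y → x ∧ (x ∨ y) ≡ x) ×
    (∀ x y → x ∨ (x ∧ y) ≡ x)

  JoinOrder : (A → A → A) → A → A → Set
  JoinOrder _∨_ x y = x ∨ y ≡ y

  MeetOrder : (A → A → A) → A → A → Set
  MeetOrder _∧_ x y = x ∧ y ≡ x

  IsWBCK* : (A → A → Set) → (A → A → A) → A → Set
  IsWBCK* _≤_ _⇒_ 𝟙 =
    IsPartialOrder _≡_ _≤_ ×
    (∀ x → x ≤ 𝟙) ×
    (∀ x y → (x ≤ y) ⇔ (x ⇒ y ≡ 𝟙)) ×
    (∀ x y z → x ≤ (y ⇒ z) → y ≤ (x ⇒ z))

  WeaklyContractive : (A → A → Set) → (A → A → A) → Set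
  WeaklyContractive _≤_ _⇒_ = ∀ x y → x ≤ (x ⇒ y) → x ≤ y

  -- in a meet-semilattice the meet x ∧ y always exists
  SectionallyJPseudocomplemented :
    (A → A → Set) → (A → A → A) → (A → A → A) → Set
  SectionallyJPseudocomplemented _≤_ _∧_ _⇒_ =
    WeaklyContractive _≤_ _⇒_ × (∀ x y → x ≤ (y ⇒ (x ∧ y)))

  IsPocrig : (A → A → Set) → (A → A → A) → (A → A → A) → A → Set
  IsPocrig _≤_ _·_ _⇒_ 𝟙 =
    IsPartialOrder _≡_ _≤_ ×
    (∀ x y → x · y ≡ y · x) ×
    (∀ x x' y y' → x ≤ x' → y ≤ y' → (x · y) ≤ (x' · y')) ×
    (∀ x → 𝟙 · x ≡ x) × (∀ x → x · 𝟙 ≡ x) ×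
    (∀ x → x ≤ 𝟙) ×
    (∀ x y z → (x ≤ (y ⇒ z)) ⇔ ((x · y) ≤ z))

bin : {A : Set} → A → A → Vec A 2
bin x y = x ∷ y ∷ []

nul : {A : Set} → Vec A 0
nul = []

data OpJI : Set where join imp : OpJI ; one : OpJI
arJI : OpJI → ℕ
arJI one = 0
arJI _   = 2
SigJI : Signature
SigJI = record { Op = OpJI ; arity = arJI }

data OpMI : Set where meet imp : OpMI ; one : OpMI
arMI : OpMI → ℕ
arMI one = 0
arMI _   = 2
SigMI : Signature
SigMI = record { Op = OpMI ; arity = arMI }

data OpLI : Set where meet join imp : OpLI ; one : OpLI
arLI : OpLI → ℕ
arLI one = 0
arLI _   = 2
SigLI : Signature
SigLI = record { Op = OpLI ; arity = arLI }

data OpJP : Set where join mul imp : OpJP ; one : OpJP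
arJP : OpJP → ℕ
arJP one = 0
arJP _   = 2
SigJP : Signature
SigJP = record { Op = OpJP ; arity = arJP }

data OpMP : Set where meet mul imp : OpMP ; one : OpMP
arMP : OpMP → ℕ
arMP one = 0
arMP _   = 2
SigMP : Signature
SigMP = record { Op = OpMP ; arity = arMP }

data OpLP : Set where meet join mul imp : OpLP ; one : OpLP
arLP : OpLP → ℕ
arLP one = 0
arLP _   = 2
SigLP : Signature
SigLP = record { Op = OpLP ; arity = arLP }

UpperWBCK*Semilattice : Algebra SigJI → Set
UpperWBCK*Semilattice 𝔸 =
  IsJoinSemilattice _∨_ × IsWBCK* (JoinOrder _∨_) _⇒_ 𝟙
  where
  _∨_ = λ x y → ⟦ 𝔸 ⟧ join (bin x y)
  _⇒_ = λ x y → ⟦ 𝔸 ⟧ imp (bin x y)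
  𝟙   = ⟦ 𝔸 ⟧ one nul

module _ (𝔸 : Algebra SigMI) where
  private
    _∧_ = λ x y → ⟦ 𝔸 ⟧ meet (bin x y)
    _⇒_ = λ x y → ⟦ 𝔸 ⟧ imp (bin x y)
    𝟙   = ⟦ 𝔸 ⟧ one nul

  LowerWBCK*Semilattice : Set
  LowerWBCK*Semilattice =
    IsMeetSemilattice _∧_ × IsWBCK* (MeetOrder _∧_) _⇒_ 𝟙

  WCLowerWBCK*Semilattice : Set
  WCLowerWBCK*Semilattice =
    LowerWBCK*Semilattice × WeaklyContractive (MeetOrder _∧_) _⇒_

  SJPLowerWBCK*Semilattice : Set
  SJPLowerWBCK*Semilattice =
    LowerWBCK*Semilattice ×
    SectionallyJPseudocomplemented (MeetOrder _∧_) _∧_ _⇒_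

module _ (𝔸 : Algebra SigLI) where
  private
    _∧_ = λ x y → ⟦ 𝔸 ⟧ meet (bin x y)
    _∨_ = λ x y → ⟦ 𝔸 ⟧ join (bin x y)
    _⇒_ = λ x y → ⟦ 𝔸 ⟧ imp (bin x y)
    𝟙   = ⟦ 𝔸 ⟧ one nul

  WBCK*Lattice : Set
  WBCK*Lattice = IsLattice _∧_ _∨_ × IsWBCK* (MeetOrder _∧_) _⇒_ 𝟙

  WCWBCK*Lattice : Set
  WCWBCK*Lattice = WBCK*Lattice × WeaklyContractive (MeetOrder _∧_) _⇒_

  SJPWBCK*Lattice : Set
  SJPWBCK*Lattice =
    WBCK*Lattice × SectionallyJPseudocomplemented (MeetOrder _∧_) _∧_ _⇒_

UpperSLPocrig : Algebra SigJP → Set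
UpperSLPocrig 𝔸 =
  IsJoinSemilattice _∨_ × IsPocrig (JoinOrder _∨_) _·_ _⇒_ 𝟙
  where
  _∨_ = λ x y → ⟦ 𝔸 ⟧ join (bin x y)
  _·_ = λ x y → ⟦ 𝔸 ⟧ mul (bin x y)
  _⇒_ = λ x y → ⟦ 𝔸 ⟧ imp (bin x y)
  𝟙   = ⟦ 𝔸 ⟧ one nul

LowerSLPocrig : Algebra SigMP → Set
LowerSLPocrig 𝔸 =
  IsMeetSemilattice _∧_ × IsPocrig (MeetOrder _∧_) _·_ _⇒_ 𝟙
  where
  _∧_ = λ x y → ⟦ 𝔸 ⟧ meet (bin x y)
  _·_ = λ x y → ⟦ 𝔸 ⟧ mul (bin x y)
  _⇒_ = λ x y → ⟦ 𝔸 ⟧ imp (bin x y)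
  𝟙   = ⟦ 𝔸 ⟧ one nul

LatticeOrderedPocrig : Algebra SigLP → Set
LatticeOrderedPocrig 𝔸 =
  IsLattice _∧_ _∨_ × IsPocrig (MeetOrder _∧_) _·_ _⇒_ 𝟙
  where
  _∧_ = λ x y → ⟦ 𝔸 ⟧ meet (bin x y)
  _∨_ = λ x y → ⟦ 𝔸 ⟧ join (bin x y)
  _·_ = λ x y → ⟦ 𝔸 ⟧ mul (bin x y)
  _⇒_ = λ x y → ⟦ 𝔸 ⟧ imp (bin x y)
  𝟙   = ⟦ 𝔸 ⟧ one nul

module Submission where

-- Each class consists of a semilattice or lattice (an equational notion)
-- with operations →, ·, 1 subject to axioms about the induced order ≤.
-- Besides identities these axioms contain quasi-identities "x ≤ y implies
-- Q x y" (antitonicity of → and x → y = 1 for wBCK*, monotonicity for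
-- pocrigs, weak contraction).  Over a semilattice order such a
-- quasi-identity is equivalent to the identity Q x (x ∨ y), resp.
-- Q (x ∧ y) y, since x ≤ x ∨ y and x ≤ y means x ∨ y = y.

open import Defs
open import Data.Bool.Base using (T)
open import Data.Nat.Base as ℕ using (ℕ; zero; suc; _≤ᵇ_; z≤n; s≤s)
open import Data.Nat.Properties using (≤ᵇ⇒≤)
open import Data.Product.Base using (_×_; _,_; Σ; proj₁; proj₂)
open import Data.Product.Function.NonDependent.Propositional using (_×-⇔_)
open import Data.Sum.Base using (_⊎_; inj₁; inj₂)
open import Data.Unit.Base using (⊤)
open import Data.Vec.Base using (Vec; []; _∷_)
open import Function.Bundles using (_⇔_; mk⇔; Equivalence)
open import Function.Construct.Composition using (_⇔-∘_)
open import Function.Construct.Identity using (⇔-id)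
open import Function.Construct.Symmetry using (⇔-sym)
open import Relation.Binary.PropositionalEquality
  using (_≡_; refl; sym; trans; cong; cong₂; subst; subst₂; isEquivalence; module ≡-Reasoning)
open import Relation.Binary.Structures using (IsPartialOrder)

open Equivalence using (to; from)

×-⇔ᵈ : {A A′ B B′ : Set} → A ⇔ A′ → (A → B ⇔ B′) → (A × B) ⇔ (A′ × B′)
×-⇔ᵈ A⇔A′ B⇔B′ = mk⇔
  (λ (a , b) → to A⇔A′ a , to (B⇔B′ a) b)
  (λ (a′ , b′) → let a = from A⇔A′ a′ in a , from (B⇔B′ a) b′)

module _ {S : Signature} where

  -- Terms (and identities) all of whose variables are among x₀, …, xₙ.
  -- The bound is a boolean test, so for a concrete term it computes to a
  -- product of ⊤'s and is filled in automatically.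
  VarsUpTo    : ℕ → Term S → Set
  VarsUpToVec : ∀ {m} → ℕ → Vec (Term S) m → Set
  VarsUpTo n (var i)   = T (i ≤ᵇ n)
  VarsUpTo n (op o ts) = VarsUpToVec n ts
  VarsUpToVec n []       = ⊤
  VarsUpToVec n (t ∷ ts) = VarsUpTo n t × VarsUpToVec n ts

  IdentityUpTo : ℕ → Equation S → Set
  IdentityUpTo n (s , t) = VarsUpTo n s × VarsUpTo n t

  eval-agree : ∀ (𝔸 : Algebra S) {n} {ρ σ : ℕ → Carrier 𝔸} →
               (∀ i → i ℕ.≤ n → ρ i ≡ σ i) →
               ∀ t → VarsUpTo n t → eval 𝔸 ρ t ≡ eval 𝔸 σ t
  evalVec-agree : ∀ (𝔸 : Algebra S) {n} {ρ σ : ℕ → Carrier 𝔸} →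
                  (∀ i → i ℕ.≤ n → ρ i ≡ σ i) →
                  ∀ {m} (ts : Vec (Term S) m) → VarsUpToVec n ts →
                  evalVec 𝔸 ρ ts ≡ evalVec 𝔸 σ ts
  eval-agree 𝔸 {n} ρ≗σ (var i) i≤n = ρ≗σ i (≤ᵇ⇒≤ i n i≤n)
  eval-agree 𝔸 ρ≗σ (op o ts) bound = cong (⟦ 𝔸 ⟧ o) (evalVec-agree 𝔸 ρ≗σ ts bound)
  evalVec-agree 𝔸 ρ≗σ []       _            = refl
  evalVec-agree 𝔸 ρ≗σ (t ∷ ts) (bt , bts) =
    cong₂ _∷_ (eval-agree 𝔸 ρ≗σ t bt) (evalVec-agree 𝔸 ρ≗σ ts bts)

module _ {C : Set} where

  assign : ∀ {n} → Vec C (suc n) → ℕ → C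
  assign {zero}  (c ∷ [])  _       = c
  assign {suc n} (c ∷ cs) zero    = c
  assign {suc n} (c ∷ cs) (suc i) = assign cs i

  prefix : (n : ℕ) → (ℕ → C) → Vec C (suc n)
  prefix zero    ρ = ρ 0 ∷ []
  prefix (suc n) ρ = ρ 0 ∷ prefix n (λ i → ρ (suc i))

  assign-prefix : ∀ n ρ i → i ℕ.≤ n → assign (prefix n ρ) i ≡ ρ i
  assign-prefix zero    ρ zero    z≤n       = refl
  assign-prefix (suc n) ρ zero    z≤n       = refl
  assign-prefix (suc n) ρ (suc i) (s≤s i≤n) = assign-prefix n (λ j → ρ (suc j)) i i≤n

  ∀ⁿ : ∀ n → (Vec C n → Set) → Set
  ∀ⁿ zero    P = P []
  ∀ⁿ (suc n) P = ∀ c → ∀ⁿ n (λ cs → P (c ∷ cs))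

  ∀ⁿ⇔∀ : ∀ n {P : Vec C n → Set} → ∀ⁿ n P ⇔ (∀ cs → P cs)
  ∀ⁿ⇔∀ n = mk⇔ (uncurry n) (curry n)
    where
    uncurry : ∀ n {P : Vec C n → Set} → ∀ⁿ n P → ∀ cs → P cs
    uncurry zero    p []       = p
    uncurry (suc n) p (c ∷ cs) = uncurry n (p c) cs
    curry : ∀ n {P : Vec C n → Set} → (∀ cs → P cs) → ∀ⁿ n P
    curry zero    p = p []
    curry (suc n) p = λ c → curry n (λ cs → p (c ∷ cs))

module _ {S : Signature} where

  -- For a concrete identity this unfolds to the familiar
  -- statement ∀ c₀ … cₙ → lhs ≡ rhs about the operations of 𝔸.
  _⊨[_]_ : Algebra S → ℕ → Equation S → Set
  𝔸 ⊨[ n ] (s , t) = ∀ⁿ (suc n) λ cs → eval 𝔸 (assign cs) s ≡ eval 𝔸 (assign cs) t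

  valid⇔holds : ∀ (𝔸 : Algebra S) n e → IdentityUpTo n e → 𝔸 ⊨ e ⇔ 𝔸 ⊨[ n ] e
  valid⇔holds 𝔸 n (s , t) (s-bound , t-bound) =
    ⇔-sym (∀ⁿ⇔∀ (suc n)) ⇔-∘ mk⇔ (λ valid cs → valid (assign cs)) holds⇒valid
    where
    holds⇒valid : (∀ cs → eval 𝔸 (assign cs) s ≡ eval 𝔸 (assign cs) t) → 𝔸 ⊨ (s , t)
    holds⇒valid holds ρ = begin
      eval 𝔸 ρ s                    ≡⟨ eval-agree 𝔸 ρ≗prefix s s-bound ⟩
      eval 𝔸 (assign (prefix n ρ)) s ≡⟨ holds (prefix n ρ) ⟩
      eval 𝔸 (assign (prefix n ρ)) t ≡⟨ sym (eval-agree 𝔸 ρ≗prefix t t-bound) ⟩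
      eval 𝔸 ρ t                    ∎
      where
      open ≡-Reasoning
      ρ≗prefix : ∀ i → i ℕ.≤ n → ρ i ≡ assign (prefix n ρ) i
      ρ≗prefix i i≤n = sym (assign-prefix n ρ i i≤n)

  identityED : ∀ n e → {IdentityUpTo n e} →
               EquationallyDefinable (λ 𝔸 → 𝔸 ⊨[ n ] e)
  identityED n e {bound} = (_≡ e) , λ 𝔸 → mk⇔
    (λ holds → λ { _ refl → from (valid⇔holds 𝔸 n e bound) holds })
    (λ valid → to (valid⇔holds 𝔸 n e bound) (valid e refl))

  infixr 4 _∩_
  _∩_ : ∀ {K L : Algebra S → Set} →
        EquationallyDefinable K → EquationallyDefinable L →
        EquationallyDefinable (λ 𝔸 → K 𝔸 × L 𝔸)
  (E , K⇔E) ∩ (F , L⇔F) = (λ e → E e ⊎ F e) , λ 𝔸 → mk⇔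
    (λ (k , l) → λ { e (inj₁ Ee) → to (K⇔E 𝔸) k e Ee
                   ; e (inj₂ Fe) → to (L⇔F 𝔸) l e Fe })
    (λ valid → from (K⇔E 𝔸) (λ e Ee → valid e (inj₁ Ee))
             , from (L⇔F 𝔸) (λ e Fe → valid e (inj₂ Fe)))

  ED-⇔ : ∀ {K L : Algebra S → Set} → (∀ 𝔸 → K 𝔸 ⇔ L 𝔸) →
         EquationallyDefinable L → EquationallyDefinable K
  ED-⇔ K⇔L (E , L⇔E) = E , λ 𝔸 → L⇔E 𝔸 ⇔-∘ K⇔L 𝔸

record SigMorphism (S S′ : Signature) : Set where
  field
    map-op    : Op S → Op S′
    map-arity : ∀ o → arity S′ (map-op o) ≡ arity S o
open SigMorphism

module _ {S S′ : Signature} (h : SigMorphism S S′) where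

  reduct : Algebra S′ → Algebra S
  reduct 𝔸 = record
    { Carrier = Carrier 𝔸
    ; ⟦_⟧     = λ o cs → ⟦ 𝔸 ⟧ (map-op h o) (subst (Vec (Carrier 𝔸)) (sym (map-arity h o)) cs)
    }

  translate    : Term S → Term S′
  translateVec : ∀ {m} → Vec (Term S) m → Vec (Term S′) m
  translate (var i)   = var i
  translate (op o ts) = op (map-op h o) (subst (Vec (Term S′)) (sym (map-arity h o)) (translateVec ts))
  translateVec []       = []
  translateVec (t ∷ ts) = translate t ∷ translateVec ts

  evalVec-subst : ∀ (𝔸 : Algebra S′) ρ {m n} (m≡n : m ≡ n) (ts : Vec (Term S′) m) →
                  evalVec 𝔸 ρ (subst (Vec (Term S′)) m≡n ts)
                    ≡ subst (Vec (Carrier 𝔸)) m≡n (evalVec 𝔸 ρ ts)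
  evalVec-subst 𝔸 ρ refl ts = refl

  eval-translate    : ∀ (𝔸 : Algebra S′) ρ t →
                      eval 𝔸 ρ (translate t) ≡ eval (reduct 𝔸) ρ t
  evalVec-translate : ∀ (𝔸 : Algebra S′) ρ {m} (ts : Vec (Term S) m) →
                      evalVec 𝔸 ρ (translateVec ts) ≡ evalVec (reduct 𝔸) ρ ts
  eval-translate 𝔸 ρ (var i)   = refl
  eval-translate 𝔸 ρ (op o ts) = cong (⟦ 𝔸 ⟧ (map-op h o)) (begin
    evalVec 𝔸 ρ (subst (Vec (Term S′)) o≡ (translateVec ts))  ≡⟨ evalVec-subst 𝔸 ρ o≡ _ ⟩
    subst (Vec (Carrier 𝔸)) o≡ (evalVec 𝔸 ρ (translateVec ts)) ≡⟨ cong (subst _ o≡) (evalVec-translate 𝔸 ρ ts) ⟩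
    subst (Vec (Carrier 𝔸)) o≡ (evalVec (reduct 𝔸) ρ ts)       ∎)
    where
    open ≡-Reasoning
    o≡ : arity S o ≡ arity S′ (map-op h o)
    o≡ = sym (map-arity h o)
  evalVec-translate 𝔸 ρ []       = refl
  evalVec-translate 𝔸 ρ (t ∷ ts) = cong₂ _∷_ (eval-translate 𝔸 ρ t) (evalVec-translate 𝔸 ρ ts)

  translateEq : Equation S → Equation S′
  translateEq (s , t) = translate s , translate t

  ⊨-translate : ∀ (𝔸 : Algebra S′) e → 𝔸 ⊨ translateEq e ⇔ reduct 𝔸 ⊨ e
  ⊨-translate 𝔸 (s , t) = mk⇔
    (λ valid ρ → trans (sym (eval-translate 𝔸 ρ s)) (trans (valid ρ) (eval-translate 𝔸 ρ t)))
    (λ valid ρ → trans (eval-translate 𝔸 ρ s) (trans (valid ρ) (sym (eval-translate 𝔸 ρ t))))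

  reductED : ∀ {K : Algebra S → Set} → EquationallyDefinable K →
             EquationallyDefinable (λ 𝔸 → K (reduct 𝔸))
  reductED (E , K⇔E) = E′ , λ 𝔸 → mk⇔
    (λ k → λ { _ (e , Ee , refl) → from (⊨-translate 𝔸 e) (to (K⇔E (reduct 𝔸)) k e Ee) })
    (λ valid → from (K⇔E (reduct 𝔸)) λ e Ee → to (⊨-translate 𝔸 e) (valid _ (e , Ee , refl)))
    where
    E′ : Equation S′ → Set
    E′ e′ = Σ (Equation S) λ e → E e × translateEq e ≡ e′

module _ {A : Set} where

  Guarded : (A → A → Set) → (A → A → Set) → Set
  Guarded _≤_ Q = ∀ x y → x ≤ y → Q x y

  -- Its unguarded forms in a join- resp. meet-semilattice: the guard x ≤ y
  -- is discharged by substituting x ∨ y for y, resp. x ∧ y for x.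
  JoinGuard : (A → A → A) → (A → A → Set) → Set
  JoinGuard _∨_ Q = ∀ x y → Q x (x ∨ y)

  MeetGuard : (A → A → A) → (A → A → Set) → Set
  MeetGuard _∧_ Q = ∀ x y → Q (x ∧ y) y

  ContractionIdentity : (A → A → A) → (A → A → A) → Set
  ContractionIdentity _∧_ _⇒_ = ∀ x y → MeetOrder _∧_ (x ∧ (x ⇒ y)) y

module JoinSemilatticeOrder {A : Set} {_∨_ : A → A → A} (sl : IsJoinSemilattice _∨_) where
  open ≡-Reasoning
  private
    _≤_ = JoinOrder _∨_
    ∨-assoc = proj₁ sl
    ∨-comm  = proj₁ (proj₂ sl)
    ∨-idem  = proj₂ (proj₂ sl)

  isPartialOrder : IsPartialOrder _≡_ _≤_
  isPartialOrder = record
    { isPreorder = record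
      { isEquivalence = isEquivalence
      ; reflexive     = λ { {x} refl → ∨-idem x }
      ; trans         = λ {x} {y} {z} x≤y y≤z → begin
          x ∨ z        ≡⟨ cong (x ∨_) (sym y≤z) ⟩
          x ∨ (y ∨ z)  ≡⟨ sym (∨-assoc x y z) ⟩
          (x ∨ y) ∨ z  ≡⟨ cong (_∨ z) x≤y ⟩
          y ∨ z        ≡⟨ y≤z ⟩
          z            ∎
      }
    ; antisym = λ {x} {y} x≤y y≤x → begin
        x      ≡⟨ sym y≤x ⟩
        y ∨ x  ≡⟨ ∨-comm y x ⟩
        x ∨ y  ≡⟨ x≤y ⟩
        y      ∎
    }

  x≤x∨y : ∀ x y → x ≤ (x ∨ y)
  x≤x∨y x y = begin
    x ∨ (x ∨ y)  ≡⟨ sym (∨-assoc x x y) ⟩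
    (x ∨ x) ∨ y  ≡⟨ cong (_∨ y) (∨-idem x) ⟩
    x ∨ y        ∎

  guard⇔ : ∀ Q → Guarded _≤_ Q ⇔ JoinGuard _∨_ Q
  guard⇔ Q = mk⇔ (λ guarded x y → guarded x (x ∨ y) (x≤x∨y x y))
                 (λ unguarded x y x≤y → subst (Q x) x≤y (unguarded x y))

module MeetSemilatticeOrder {A : Set} {_∧_ : A → A → A} (sl : IsMeetSemilattice _∧_) where
  open ≡-Reasoning
  private
    _≤_ = MeetOrder _∧_
    ∧-assoc = proj₁ sl
    ∧-comm  = proj₁ (proj₂ sl)
    ∧-idem  = proj₂ (proj₂ sl)

  isPartialOrder : IsPartialOrder _≡_ _≤_
  isPartialOrder = record
    { isPreorder = record
      { isEquivalence = isEquivalence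
      ; reflexive     = λ { {x} refl → ∧-idem x }
      ; trans         = λ {x} {y} {z} x≤y y≤z → begin
          x ∧ z        ≡⟨ cong (_∧ z) (sym x≤y) ⟩
          (x ∧ y) ∧ z  ≡⟨ ∧-assoc x y z ⟩
          x ∧ (y ∧ z)  ≡⟨ cong (x ∧_) y≤z ⟩
          x ∧ y        ≡⟨ x≤y ⟩
          x            ∎
      }
    ; antisym = λ {x} {y} x≤y y≤x → begin
        x      ≡⟨ sym x≤y ⟩
        x ∧ y  ≡⟨ ∧-comm x y ⟩
        y ∧ x  ≡⟨ y≤x ⟩
        y      ∎
    }

  x∧y≤y : ∀ x y → (x ∧ y) ≤ y
  x∧y≤y x y = begin
    (x ∧ y) ∧ y  ≡⟨ ∧-assoc x y y ⟩
    x ∧ (y ∧ y)  ≡⟨ cong (x ∧_) (∧-idem y) ⟩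
    x ∧ y        ∎

  x∧y≤x : ∀ x y → (x ∧ y) ≤ x
  x∧y≤x x y = begin
    (x ∧ y) ∧ x  ≡⟨ cong (_∧ x) (∧-comm x y) ⟩
    (y ∧ x) ∧ x  ≡⟨ x∧y≤y y x ⟩
    y ∧ x        ≡⟨ ∧-comm y x ⟩
    x ∧ y        ∎

  guard⇔ : ∀ Q → Guarded _≤_ Q ⇔ MeetGuard _∧_ Q
  guard⇔ Q = mk⇔ (λ guarded x y → guarded (x ∧ y) y (x∧y≤y x y))
                 (λ unguarded x y x≤y → subst (λ u → Q u y) x≤y (unguarded x y))

-- The wBCK* axioms over a partial order, recast as three identities and two
-- quasi-identities in x, y (presented through a guard G).
module WBCK*Laws {A : Set} (_≤_ : A → A → Set) (_⇒_ : A → A → A) (𝟙 : A) where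

  Antitone ImpliesOne : A → A → Set
  Antitone   x y = ∀ z → (y ⇒ z) ≤ (x ⇒ z)
  ImpliesOne x y = x ⇒ y ≡ 𝟙

  Laws : ((A → A → Set) → Set) → Set
  Laws G = (∀ x → x ≤ 𝟙) × (∀ x → 𝟙 ⇒ x ≡ x) × (∀ x y → x ≤ ((x ⇒ y) ⇒ y))
         × G Antitone × G ImpliesOne

  laws-cong : ∀ {G G′} → (∀ Q → G Q ⇔ G′ Q) → Laws G ⇔ Laws G′
  laws-cong G⇔G′ = ⇔-id _ ×-⇔ ⇔-id _ ×-⇔ ⇔-id _ ×-⇔ G⇔G′ Antitone ×-⇔ G⇔G′ ImpliesOne

  module _ (po : IsPartialOrder _≡_ _≤_) where
    open IsPartialOrder po using (antisym; reflexive) renaming (refl to ≤-refl; trans to ≤-trans)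

    isWBCK*⇔laws : IsWBCK* _≤_ _⇒_ 𝟙 ⇔ Laws (Guarded _≤_)
    isWBCK*⇔laws = mk⇔ laws wbck*
      where
      laws : IsWBCK* _≤_ _⇒_ 𝟙 → Laws (Guarded _≤_)
      laws (_ , top , ≤⇔⇒𝟙 , exchange) =
        top , 𝟙⇒x≡x , x≤[x⇒y]⇒y , antitone , λ x y → to (≤⇔⇒𝟙 x y)
        where
        x≤[x⇒y]⇒y : ∀ x y → x ≤ ((x ⇒ y) ⇒ y)
        x≤[x⇒y]⇒y x y = exchange (x ⇒ y) x y ≤-refl

        antitone : Guarded _≤_ Antitone
        antitone x y x≤y z = exchange x (y ⇒ z) z (≤-trans x≤y (x≤[x⇒y]⇒y y z))

        -- 𝟙 ⇒ x ≤ x since (𝟙 ⇒ x) ⇒ x lies above 𝟙, and x ≤ 𝟙 ⇒ x since 𝟙 ≤ x ⇒ x.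
        𝟙⇒x≡x : ∀ x → 𝟙 ⇒ x ≡ x
        𝟙⇒x≡x x = antisym (from (≤⇔⇒𝟙 (𝟙 ⇒ x) x) (antisym (top _) (x≤[x⇒y]⇒y 𝟙 x)))
                          (exchange 𝟙 x x (reflexive (sym (to (≤⇔⇒𝟙 x x) ≤-refl))))

      wbck* : Laws (Guarded _≤_) → IsWBCK* _≤_ _⇒_ 𝟙
      wbck* (top , 𝟙⇒x≡x , x≤[x⇒y]⇒y , antitone , ≤⇒⇒𝟙) =
        po , top , (λ x y → mk⇔ (≤⇒⇒𝟙 x y) (⇒𝟙⇒≤ x y)) , exchange
        where
        ⇒𝟙⇒≤ : ∀ x y → x ⇒ y ≡ 𝟙 → x ≤ y
        ⇒𝟙⇒≤ x y x⇒y≡𝟙 =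
          subst (x ≤_) (trans (cong (_⇒ y) x⇒y≡𝟙) (𝟙⇒x≡x y)) (x≤[x⇒y]⇒y x y)

        exchange : ∀ x y z → x ≤ (y ⇒ z) → y ≤ (x ⇒ z)
        exchange x y z x≤y⇒z = ≤-trans (x≤[x⇒y]⇒y y z) (antitone x (y ⇒ z) x≤y⇒z z)

-- The pocrig axioms over a partial order, recast as identities and two
-- quasi-identities (monotonicity of · and of ⇒ in the second argument).
module PocrigLaws {A : Set} (_≤_ : A → A → Set) (_·_ _⇒_ : A → A → A) (𝟙 : A) where

  MonotoneLeft MonotoneRight : A → A → Set
  MonotoneLeft  x x′ = ∀ y → (x · y) ≤ (x′ · y)
  MonotoneRight z z′ = ∀ y → (y ⇒ z) ≤ (y ⇒ z′)

  Laws : ((A → A → Set) → Set) → Set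
  Laws G = (∀ x y → x · y ≡ y · x) × G MonotoneLeft
         × (∀ x → 𝟙 · x ≡ x) × (∀ x → x · 𝟙 ≡ x) × (∀ x → x ≤ 𝟙)
         × (∀ y z → ((y ⇒ z) · y) ≤ z) × (∀ x y → x ≤ (y ⇒ (x · y)))
         × G MonotoneRight

  laws-cong : ∀ {G G′} → (∀ Q → G Q ⇔ G′ Q) → Laws G ⇔ Laws G′
  laws-cong G⇔G′ = ⇔-id _ ×-⇔ G⇔G′ MonotoneLeft ×-⇔ ⇔-id _ ×-⇔ ⇔-id _ ×-⇔ ⇔-id _
                   ×-⇔ ⇔-id _ ×-⇔ ⇔-id _ ×-⇔ G⇔G′ MonotoneRight

  module _ (po : IsPartialOrder _≡_ _≤_) where
    open IsPartialOrder po using () renaming (refl to ≤-refl; trans to ≤-trans)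

    -- The residuation x ≤ y ⇒ z ⇔ x · y ≤ z amounts to modus ponens
    -- (y ⇒ z) · y ≤ z, its unit x ≤ y ⇒ x · y, and monotonicity.
    isPocrig⇔laws : IsPocrig _≤_ _·_ _⇒_ 𝟙 ⇔ Laws (Guarded _≤_)
    isPocrig⇔laws = mk⇔ laws pocrig
      where
      laws : IsPocrig _≤_ _·_ _⇒_ 𝟙 → Laws (Guarded _≤_)
      laws (_ , comm , monotone , unitˡ , unitʳ , top , residuation) =
        comm , (λ x x′ x≤x′ y → monotone x x′ y y x≤x′ ≤-refl) , unitˡ , unitʳ , top
        , modusPonens , (λ x y → from (residuation x y (x · y)) ≤-refl) , ⇒-monotone
        where
        modusPonens : ∀ y z → ((y ⇒ z) · y) ≤ z
        modusPonens y z = to (residuation (y ⇒ z) y z) ≤-refl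

        ⇒-monotone : Guarded _≤_ MonotoneRight
        ⇒-monotone z z′ z≤z′ y = from (residuation (y ⇒ z) y z′) (≤-trans (modusPonens y z) z≤z′)

      pocrig : Laws (Guarded _≤_) → IsPocrig _≤_ _·_ _⇒_ 𝟙
      pocrig (comm , ·-monotoneˡ , unitˡ , unitʳ , top , modusPonens , x≤y⇒xy , ⇒-monotone) =
        po , comm , monotone , unitˡ , unitʳ , top , λ x y z → mk⇔ (uncurry x y z) (curry x y z)
        where
        monotone : ∀ x x′ y y′ → x ≤ x′ → y ≤ y′ → (x · y) ≤ (x′ · y′)
        monotone x x′ y y′ x≤x′ y≤y′ =
          ≤-trans (·-monotoneˡ x x′ x≤x′ y)
                  (subst₂ _≤_ (comm y x′) (comm y′ x′) (·-monotoneˡ y y′ y≤y′ x′))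

        uncurry : ∀ x y z → x ≤ (y ⇒ z) → (x · y) ≤ z
        uncurry x y z x≤y⇒z = ≤-trans (·-monotoneˡ x (y ⇒ z) x≤y⇒z y) (modusPonens y z)

        curry : ∀ x y z → (x · y) ≤ z → x ≤ (y ⇒ z)
        curry x y z xy≤z = ≤-trans (x≤y⇒xy x y) (⇒-monotone (x · y) z xy≤z y)

module JoinOrdered {A : Set} {_∨_ _⇒_ : A → A → A} {𝟙 : A} where

  wbck*⇔ : (IsJoinSemilattice _∨_ × IsWBCK* (JoinOrder _∨_) _⇒_ 𝟙)
         ⇔ (IsJoinSemilattice _∨_ × WBCK*Laws.Laws (JoinOrder _∨_) _⇒_ 𝟙 (JoinGuard _∨_))
  wbck*⇔ = ×-⇔ᵈ (⇔-id (IsJoinSemilattice _∨_)) λ sl → let open JoinSemilatticeOrder sl in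
    WBCK*Laws.laws-cong _ _ _ guard⇔ ⇔-∘ WBCK*Laws.isWBCK*⇔laws _ _ _ isPartialOrder

  pocrig⇔ : ∀ {_·_} →
            (IsJoinSemilattice _∨_ × IsPocrig (JoinOrder _∨_) _·_ _⇒_ 𝟙)
          ⇔ (IsJoinSemilattice _∨_ × PocrigLaws.Laws (JoinOrder _∨_) _·_ _⇒_ 𝟙 (JoinGuard _∨_))
  pocrig⇔ = ×-⇔ᵈ (⇔-id (IsJoinSemilattice _∨_)) λ sl → let open JoinSemilatticeOrder sl in
    PocrigLaws.laws-cong _ _ _ _ guard⇔ ⇔-∘ PocrigLaws.isPocrig⇔laws _ _ _ _ isPartialOrder

-- The structure P carrying the
-- order is arbitrary (a meet-semilattice or a lattice).
module MeetOrdered {A : Set} {_∧_ _⇒_ : A → A → A} {𝟙 : A} {P : Set}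
                   (meetSemilattice : P → IsMeetSemilattice _∧_) where
  private
    _≤_ = MeetOrder _∧_

  wbck*⇔ : (P × IsWBCK* _≤_ _⇒_ 𝟙) ⇔ (P × WBCK*Laws.Laws _≤_ _⇒_ 𝟙 (MeetGuard _∧_))
  wbck*⇔ = ×-⇔ᵈ (⇔-id P) λ p → let open MeetSemilatticeOrder (meetSemilattice p) in
    WBCK*Laws.laws-cong _ _ _ guard⇔ ⇔-∘ WBCK*Laws.isWBCK*⇔laws _ _ _ isPartialOrder

  pocrig⇔ : ∀ {_·_} →
            (P × IsPocrig _≤_ _·_ _⇒_ 𝟙) ⇔ (P × PocrigLaws.Laws _≤_ _·_ _⇒_ 𝟙 (MeetGuard _∧_))
  pocrig⇔ = ×-⇔ᵈ (⇔-id P) λ p → let open MeetSemilatticeOrder (meetSemilattice p) in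
    PocrigLaws.laws-cong _ _ _ _ guard⇔ ⇔-∘ PocrigLaws.isPocrig⇔laws _ _ _ _ isPartialOrder

  -- If x ≤ x ⇒ y then x = x ∧ (x ⇒ y) ≤ y; conversely a = x ∧ (x ⇒ y)
  -- satisfies a ≤ x ⇒ y ≤ a ⇒ y by antitonicity, so weak contraction gives a ≤ y.
  weaklyContractive⇔ : P → IsWBCK* _≤_ _⇒_ 𝟙 →
                       WeaklyContractive _≤_ _⇒_ ⇔ ContractionIdentity _∧_ _⇒_
  weaklyContractive⇔ p wbck* = mk⇔
    (λ contractive x y → contractive (x ∧ (x ⇒ y)) y
       (≤-trans (x∧y≤y x (x ⇒ y)) (antitone (x ∧ (x ⇒ y)) x (x∧y≤x x (x ⇒ y)) y)))
    (λ contraction x y x≤x⇒y → subst (_≤ y) x≤x⇒y (contraction x y))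
    where
    open MeetSemilatticeOrder (meetSemilattice p)
    open IsPartialOrder isPartialOrder using () renaming (trans to ≤-trans)
    antitone : Guarded _≤_ (WBCK*Laws.Antitone _≤_ _⇒_ 𝟙)
    antitone = let (_ , _ , _ , antitone , _) = to (WBCK*Laws.isWBCK*⇔laws _ _ _ isPartialOrder) wbck*
               in antitone

  weaklyContractiveClass⇔ :
    ((P × IsWBCK* _≤_ _⇒_ 𝟙) × WeaklyContractive _≤_ _⇒_)
    ⇔ ((P × WBCK*Laws.Laws _≤_ _⇒_ 𝟙 (MeetGuard _∧_)) × ContractionIdentity _∧_ _⇒_)
  weaklyContractiveClass⇔ = ×-⇔ᵈ wbck*⇔ λ (p , wbck*) → weaklyContractive⇔ p wbck*

  sectionallyJPseudocomplementedClass⇔ :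
    ((P × IsWBCK* _≤_ _⇒_ 𝟙) × SectionallyJPseudocomplemented _≤_ _∧_ _⇒_)
    ⇔ ((P × WBCK*Laws.Laws _≤_ _⇒_ 𝟙 (MeetGuard _∧_))
       × (ContractionIdentity _∧_ _⇒_ × (∀ x y → x ≤ (y ⇒ (x ∧ y)))))
  sectionallyJPseudocomplementedClass⇔ =
    ×-⇔ᵈ wbck*⇔ λ (p , wbck*) → weaklyContractive⇔ p wbck* ×-⇔ ⇔-id _

x₀ x₁ x₂ : {S : Signature} → Term S
x₀ = var 0
x₁ = var 1
x₂ = var 2

data BinarySymbol : Set where
  bop : BinarySymbol

SigBin : Signature
SigBin = record { Op = BinarySymbol ; arity = λ _ → 2 }

IsSemilatticeAlgebra : Algebra SigBin → Set
IsSemilatticeAlgebra 𝔸 = IsJoinSemilattice (λ x y → ⟦ 𝔸 ⟧ bop (bin x y))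

interpretAs : ∀ {S} (o : Op S) → arity S o ≡ 2 → SigMorphism SigBin S
interpretAs o o-binary = record { map-op = λ _ → o ; map-arity = λ _ → o-binary }

semilatticeED : EquationallyDefinable IsSemilatticeAlgebra
semilatticeED = identityED 2 ((x₀ ∙ x₁) ∙ x₂ , x₀ ∙ (x₁ ∙ x₂))
              ∩ identityED 1 (x₀ ∙ x₁ , x₁ ∙ x₀)
              ∩ identityED 0 (x₀ ∙ x₀ , x₀)
  where
  _∙_ : Term SigBin → Term SigBin → Term SigBin
  s ∙ t = op bop (s ∷ t ∷ [])

module JI-Algebra (𝔸 : Algebra SigJI) where
  _∨_ _⇒_ : Carrier 𝔸 → Carrier 𝔸 → Carrier 𝔸
  x ∨ y = ⟦ 𝔸 ⟧ join (bin x y)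
  x ⇒ y = ⟦ 𝔸 ⟧ imp (bin x y)
  𝟙 : Carrier 𝔸
  𝟙 = ⟦ 𝔸 ⟧ one nul

  WBCK*Identities : Set
  WBCK*Identities = WBCK*Laws.Laws (JoinOrder _∨_) _⇒_ 𝟙 (JoinGuard _∨_)

module JI-Terms where
  _∨_ _⇒_ : Term SigJI → Term SigJI → Term SigJI
  s ∨ t = op join (s ∷ t ∷ [])
  s ⇒ t = op imp (s ∷ t ∷ [])
  𝟏 : Term SigJI
  𝟏 = op one []
  _≤_ : Term SigJI → Term SigJI → Equation SigJI
  s ≤ t = s ∨ t , t

  wbck*ED : EquationallyDefinable JI-Algebra.WBCK*Identities
  wbck*ED = identityED 0 (x₀ ≤ 𝟏)
          ∩ identityED 0 (𝟏 ⇒ x₀ , x₀)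
          ∩ identityED 1 (x₀ ≤ ((x₀ ⇒ x₁) ⇒ x₁))
          ∩ identityED 2 (((x₀ ∨ x₁) ⇒ x₂) ≤ (x₀ ⇒ x₂))
          ∩ identityED 1 (x₀ ⇒ (x₀ ∨ x₁) , 𝟏)

upperWBCK*SemilatticeED : EquationallyDefinable UpperWBCK*Semilattice
upperWBCK*SemilatticeED = ED-⇔ (λ _ → JoinOrdered.wbck*⇔)
  (reductED (interpretAs join refl) semilatticeED ∩ JI-Terms.wbck*ED)

module MI-Algebra (𝔸 : Algebra SigMI) where
  _∧_ _⇒_ : Carrier 𝔸 → Carrier 𝔸 → Carrier 𝔸
  x ∧ y = ⟦ 𝔸 ⟧ meet (bin x y)
  x ⇒ y = ⟦ 𝔸 ⟧ imp (bin x y)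
  𝟙 : Carrier 𝔸
  𝟙 = ⟦ 𝔸 ⟧ one nul

  IsMeetSemilatticeAlgebra : Set
  IsMeetSemilatticeAlgebra = IsMeetSemilattice _∧_

  WBCK*Identities : Set
  WBCK*Identities = WBCK*Laws.Laws (MeetOrder _∧_) _⇒_ 𝟙 (MeetGuard _∧_)

  ContractionIdentityHolds : Set
  ContractionIdentityHolds = ContractionIdentity _∧_ _⇒_

  SJIdentityHolds : Set
  SJIdentityHolds = ∀ x y → MeetOrder _∧_ x (y ⇒ (x ∧ y))

module MI-Terms where
  _∧_ _⇒_ : Term SigMI → Term SigMI → Term SigMI
  s ∧ t = op meet (s ∷ t ∷ [])
  s ⇒ t = op imp (s ∷ t ∷ [])
  𝟏 : Term SigMI
  𝟏 = op one []
  _≤_ : Term SigMI → Term SigMI → Equation SigMI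
  s ≤ t = s ∧ t , s

  meetSemilatticeED : EquationallyDefinable MI-Algebra.IsMeetSemilatticeAlgebra
  meetSemilatticeED = reductED (interpretAs meet refl) semilatticeED

  wbck*ED : EquationallyDefinable MI-Algebra.WBCK*Identities
  wbck*ED = identityED 0 (x₀ ≤ 𝟏)
          ∩ identityED 0 (𝟏 ⇒ x₀ , x₀)
          ∩ identityED 1 (x₀ ≤ ((x₀ ⇒ x₁) ⇒ x₁))
          ∩ identityED 2 ((x₁ ⇒ x₂) ≤ ((x₀ ∧ x₁) ⇒ x₂))
          ∩ identityED 1 ((x₀ ∧ x₁) ⇒ x₁ , 𝟏)

  contractionED : EquationallyDefinable MI-Algebra.ContractionIdentityHolds
  contractionED = identityED 1 ((x₀ ∧ (x₀ ⇒ x₁)) ≤ x₁)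

  sjED : EquationallyDefinable MI-Algebra.SJIdentityHolds
  sjED = identityED 1 (x₀ ≤ (x₁ ⇒ (x₀ ∧ x₁)))

lowerWBCK*SemilatticeED : EquationallyDefinable LowerWBCK*Semilattice
lowerWBCK*SemilatticeED = ED-⇔ (λ _ → MeetOrdered.wbck*⇔ λ sl → sl)
  (MI-Terms.meetSemilatticeED ∩ MI-Terms.wbck*ED)

wcLowerWBCK*SemilatticeED : EquationallyDefinable WCLowerWBCK*Semilattice
wcLowerWBCK*SemilatticeED = ED-⇔ (λ _ → MeetOrdered.weaklyContractiveClass⇔ λ sl → sl)
  ((MI-Terms.meetSemilatticeED ∩ MI-Terms.wbck*ED) ∩ MI-Terms.contractionED)

sjpLowerWBCK*SemilatticeED : EquationallyDefinable SJPLowerWBCK*Semilattice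
sjpLowerWBCK*SemilatticeED = ED-⇔ (λ _ → MeetOrdered.sectionallyJPseudocomplementedClass⇔ λ sl → sl)
  ((MI-Terms.meetSemilatticeED ∩ MI-Terms.wbck*ED) ∩ MI-Terms.contractionED ∩ MI-Terms.sjED)

module LI-Algebra (𝔸 : Algebra SigLI) where
  IsLatticeAlgebra : Set
  IsLatticeAlgebra = IsLattice (λ x y → ⟦ 𝔸 ⟧ meet (bin x y)) (λ x y → ⟦ 𝔸 ⟧ join (bin x y))

module LI-Terms where
  _∧_ _∨_ : Term SigLI → Term SigLI → Term SigLI
  s ∧ t = op meet (s ∷ t ∷ [])
  s ∨ t = op join (s ∷ t ∷ [])

  fromMI : SigMorphism SigMI SigLI
  fromMI = record
    { map-op    = λ { meet → meet ; imp → imp ; one → one }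
    ; map-arity = λ { meet → refl ; imp → refl ; one → refl } }

  latticeED : EquationallyDefinable LI-Algebra.IsLatticeAlgebra
  latticeED = reductED (interpretAs meet refl) semilatticeED
            ∩ reductED (interpretAs join refl) semilatticeED
            ∩ identityED 1 (x₀ ∧ (x₀ ∨ x₁) , x₀)
            ∩ identityED 1 (x₀ ∨ (x₀ ∧ x₁) , x₀)

wbck*LatticeED : EquationallyDefinable WBCK*Lattice
wbck*LatticeED = ED-⇔ (λ _ → MeetOrdered.wbck*⇔ proj₁)
  (LI-Terms.latticeED ∩ reductED LI-Terms.fromMI MI-Terms.wbck*ED)

wcWBCK*LatticeED : EquationallyDefinable WCWBCK*Lattice
wcWBCK*LatticeED = ED-⇔ (λ _ → MeetOrdered.weaklyContractiveClass⇔ proj₁)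
  ((LI-Terms.latticeED ∩ reductED LI-Terms.fromMI MI-Terms.wbck*ED)
   ∩ reductED LI-Terms.fromMI MI-Terms.contractionED)

sjpWBCK*LatticeED : EquationallyDefinable SJPWBCK*Lattice
sjpWBCK*LatticeED = ED-⇔ (λ _ → MeetOrdered.sectionallyJPseudocomplementedClass⇔ proj₁)
  ((LI-Terms.latticeED ∩ reductED LI-Terms.fromMI MI-Terms.wbck*ED)
   ∩ reductED LI-Terms.fromMI (MI-Terms.contractionED ∩ MI-Terms.sjED))

module JP-Algebra (𝔸 : Algebra SigJP) where
  _∨_ _·_ _⇒_ : Carrier 𝔸 → Carrier 𝔸 → Carrier 𝔸
  x ∨ y = ⟦ 𝔸 ⟧ join (bin x y)
  x · y = ⟦ 𝔸 ⟧ mul (bin x y)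
  x ⇒ y = ⟦ 𝔸 ⟧ imp (bin x y)
  𝟙 : Carrier 𝔸
  𝟙 = ⟦ 𝔸 ⟧ one nul

  PocrigIdentities : Set
  PocrigIdentities = PocrigLaws.Laws (JoinOrder _∨_) _·_ _⇒_ 𝟙 (JoinGuard _∨_)

module JP-Terms where
  _∨_ _·_ _⇒_ : Term SigJP → Term SigJP → Term SigJP
  s ∨ t = op join (s ∷ t ∷ [])
  s · t = op mul (s ∷ t ∷ [])
  s ⇒ t = op imp (s ∷ t ∷ [])
  𝟏 : Term SigJP
  𝟏 = op one []
  _≤_ : Term SigJP → Term SigJP → Equation SigJP
  s ≤ t = s ∨ t , t

  pocrigED : EquationallyDefinable JP-Algebra.PocrigIdentities
  pocrigED = identityED 1 (x₀ · x₁ , x₁ · x₀)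
           ∩ identityED 2 ((x₀ · x₂) ≤ ((x₀ ∨ x₁) · x₂))
           ∩ identityED 0 (𝟏 · x₀ , x₀)
           ∩ identityED 0 (x₀ · 𝟏 , x₀)
           ∩ identityED 0 (x₀ ≤ 𝟏)
           ∩ identityED 1 (((x₀ ⇒ x₁) · x₀) ≤ x₁)
           ∩ identityED 1 (x₀ ≤ (x₁ ⇒ (x₀ · x₁)))
           ∩ identityED 2 ((x₂ ⇒ x₀) ≤ (x₂ ⇒ (x₀ ∨ x₁)))

upperSLPocrigED : EquationallyDefinable UpperSLPocrig
upperSLPocrigED = ED-⇔ (λ _ → JoinOrdered.pocrig⇔)
  (reductED (interpretAs join refl) semilatticeED ∩ JP-Terms.pocrigED)

module MP-Algebra (𝔸 : Algebra SigMP) where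
  _∧_ _·_ _⇒_ : Carrier 𝔸 → Carrier 𝔸 → Carrier 𝔸
  x ∧ y = ⟦ 𝔸 ⟧ meet (bin x y)
  x · y = ⟦ 𝔸 ⟧ mul (bin x y)
  x ⇒ y = ⟦ 𝔸 ⟧ imp (bin x y)
  𝟙 : Carrier 𝔸
  𝟙 = ⟦ 𝔸 ⟧ one nul

  PocrigIdentities : Set
  PocrigIdentities = PocrigLaws.Laws (MeetOrder _∧_) _·_ _⇒_ 𝟙 (MeetGuard _∧_)

module MP-Terms where
  _∧_ _·_ _⇒_ : Term SigMP → Term SigMP → Term SigMP
  s ∧ t = op meet (s ∷ t ∷ [])
  s · t = op mul (s ∷ t ∷ [])
  s ⇒ t = op imp (s ∷ t ∷ [])
  𝟏 : Term SigMP
  𝟏 = op one []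
  _≤_ : Term SigMP → Term SigMP → Equation SigMP
  s ≤ t = s ∧ t , s

  pocrigED : EquationallyDefinable MP-Algebra.PocrigIdentities
  pocrigED = identityED 1 (x₀ · x₁ , x₁ · x₀)
           ∩ identityED 2 (((x₀ ∧ x₁) · x₂) ≤ (x₁ · x₂))
           ∩ identityED 0 (𝟏 · x₀ , x₀)
           ∩ identityED 0 (x₀ · 𝟏 , x₀)
           ∩ identityED 0 (x₀ ≤ 𝟏)
           ∩ identityED 1 (((x₀ ⇒ x₁) · x₀) ≤ x₁)
           ∩ identityED 1 (x₀ ≤ (x₁ ⇒ (x₀ · x₁)))
           ∩ identityED 2 ((x₂ ⇒ (x₀ ∧ x₁)) ≤ (x₂ ⇒ x₁))

lowerSLPocrigED : EquationallyDefinable LowerSLPocrig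
lowerSLPocrigED = ED-⇔ (λ _ → MeetOrdered.pocrig⇔ λ sl → sl)
  (reductED (interpretAs meet refl) semilatticeED ∩ MP-Terms.pocrigED)

fromLI : SigMorphism SigLI SigLP
fromLI = record
  { map-op    = λ { meet → meet ; join → join ; imp → imp ; one → one }
  ; map-arity = λ { meet → refl ; join → refl ; imp → refl ; one → refl } }

fromMP : SigMorphism SigMP SigLP
fromMP = record
  { map-op    = λ { meet → meet ; mul → mul ; imp → imp ; one → one }
  ; map-arity = λ { meet → refl ; mul → refl ; imp → refl ; one → refl } }

latticeOrderedPocrigED : EquationallyDefinable LatticeOrderedPocrig
latticeOrderedPocrigED = ED-⇔ (λ _ → MeetOrdered.pocrig⇔ proj₁)
  (reductED fromLI LI-Terms.latticeED ∩ reductED fromMP MP-Terms.pocrigED)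

corollary5p3 :
    EquationallyDefinable UpperWBCK*Semilattice
    × (EquationallyDefinable LowerWBCK*Semilattice
       × EquationallyDefinable WCLowerWBCK*Semilattice
       × EquationallyDefinable SJPLowerWBCK*Semilattice)
    × (EquationallyDefinable WBCK*Lattice
       × EquationallyDefinable WCWBCK*Lattice
       × EquationallyDefinable SJPWBCK*Lattice)
    × EquationallyDefinable UpperSLPocrig
    × EquationallyDefinable LowerSLPocrig
    × EquationallyDefinable LatticeOrderedPocrig
corollary5p3 =
  upperWBCK*SemilatticeED
  , (lowerWBCK*SemilatticeED , wcLowerWBCK*SemilatticeED , sjpLowerWBCK*SemilatticeED)
  , (wbck*LatticeED , wcWBCK*LatticeED , sjpWBCK*LatticeED)
  , upperSLPocrigED
  , lowerSLPocrigED
  , latticeOrderedPocrigED
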